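{- Let $(f,M)$ be a polymatroid, $X\subsetneq M$, and $(f',M')=(f,M)\,/\,X$ the contract of $(f,M)$ along $X$ (so $M'=M\setminus X$). Let $(g',N')$ be an extension of $(f',M')$. Then there is an extension $(g,N)$ of $(f,M)$, with $N=N'\cup X$, such that $(g',N')=(g,N)\,/\,X$.
   Context: A polymatroid $(f,M)$: finite $M$, $f$ on subsets of $M$ (with $f(\emptyset)=0$), non-negative, monotone, submodular. $(g,N)$ is an extension of $(f,M)$ if $N\supseteq M$ and $g(A)=f(A)$ for all $A\subseteq M$. The contract of $(f,M)$ along $X\subset M$ is the polymatroid $(h,M\setminus X)$ with $h(A)=f(A\cup X)-f(X)$ for $A\subseteq M\setminus X$.
   Formalization: The set functions f and g′ take values in ℚ rather than in the reals, and the extension g is likewise taken with values in ℚ. -}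

module Defs where

open import Data.Nat using (ℕ)
open import Data.Product using (_×_)
open import Data.Rational using (ℚ; 0ℚ; _≤_; _+_; _-_)
open import Data.Fin.Subset using (Subset; ⊥; _⊆_; _∪_; _∩_; _─_)
open import Relation.Binary.PropositionalEquality using (_≡_)

-- Finite ground sets are modelled as subsets of a finite universe Fin u.
-- A set function is a map  Subset u → ℚ ; only its values on subsets of the
-- ground set are relevant.

record IsPolymatroid {u : ℕ} (f : Subset u → ℚ) (M : Subset u) : Set where
  field
    empty       : f ⊥ ≡ 0ℚ
    nonneg      : ∀ A → A ⊆ M → 0ℚ ≤ f A
    monotone    : ∀ A B → A ⊆ B → B ⊆ M → f A ≤ f B
    submodular  : ∀ A B → A ⊆ M → B ⊆ M → f (A ∪ B) + f (A ∩ B) ≤ f A + f B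

IsExtension : {u : ℕ} → (g : Subset u → ℚ) → (N : Subset u) →
              (f : Subset u → ℚ) → (M : Subset u) → Set
IsExtension g N f M = (M ⊆ N) × (∀ A → A ⊆ M → g A ≡ f A)

-- The set function of the contract of (f , M) along X:  A ↦ f(A ∪ X) - f(X).
-- Its ground set is M ─ X.
contractFn : {u : ℕ} → (Subset u → ℚ) → Subset u → (Subset u → ℚ)
contractFn f X A = f (A ∪ X) - f X

{-# OPTIONS --safe #-}
module Submission where

-- Put g = f on subsets of M and g A = f X + g' (A ─ X) elsewhere.  The
-- second formula equals f (A ∪ X) on subsets of M, so it dominates f there,
-- and its excess over f shrinks as the set grows, because the marginal value
-- f (B ∪ X) - f B of X in a submodular f decreases in B.  These two facts are
-- exactly what keeps g monotone and submodular across the boundary of M.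
-- Contracting g along X only evaluates g on sets containing X, where both
-- formulas agree with f X + g' (A ─ X), so it gives back g'.

open import Defs
open import Data.Nat using (ℕ)
open import Data.Product using (_×_; Σ-syntax; _,_)
open import Data.Sum using (inj₁; inj₂)
open import Data.Vec using (_∷_; [])
open import Data.Vec.Base using (there)
open import Data.Rational using (ℚ; 0ℚ; _≤_; _+_; _-_; -_)
open import Data.Rational.Properties
  using (+-mono-≤; +-monoˡ-≤; +-monoʳ-≤; +-comm; ≤-refl; ≤-trans; ≤-reflexive; +-0-abelianGroup;
         module ≤-Reasoning)
open import Data.Rational.Solver using (module +-*-Solver)
open import Algebra.Properties.AbelianGroup +-0-abelianGroup using (xyx⁻¹≈y)
open import Data.Fin.Subset using (Subset; _⊆_; _⊂_; _∪_; _∩_; _─_; _∈_; _∉_; ⊥; inside; outside)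
open import Data.Fin.Subset.Properties
  using (_⊆?_; _∈?_; ⊥⊆; ⊆-trans; ⊆-antisym; p⊂q⇒p⊆q; p⊆p∪q; q⊆p∪q; x∈p∪q⁻; x∈p∩q⁺; p∩q⊆p; p∩q⊆q;
         p─q⊆p; x∈p∧x∉q⇒x∈p─q; ∪-assoc; ∪-idem; ∪-comm; ∩-comm)
open import Relation.Binary.PropositionalEquality
  using (_≡_; refl; sym; trans; cong; cong₂; subst; subst₂; module ≡-Reasoning)
open import Data.Empty using (⊥-elim)
open import Relation.Nullary using (yes; no; contradiction)

open +-*-Solver

private variable
  n : ℕ
  A M N X : Subset n
  f g' h : Subset n → ℚ

+-cancelʳ-≤ : ∀ r {p q : ℚ} → p + r ≤ q + r → p ≤ q
+-cancelʳ-≤ r {p} {q} p+r≤q+r = subst₂ _≤_ (cancel p) (cancel q) (+-monoˡ-≤ (- r) p+r≤q+r)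
  where
  cancel : ∀ x → (x + r) - r ≡ x
  cancel x = solve 2 (λ x r → (x :+ r) :- r := x) refl x r

-- Transitivity of differences: x - z ≤ w - y ≤ v - u.
≤-exchange-trans : ∀ x y z w u v → x + y ≤ z + w → w + u ≤ v + y → x + u ≤ z + v
≤-exchange-trans x y z w u v xy≤zw wu≤vy =
  +-cancelʳ-≤ (y + w) (subst₂ _≤_ (regroupˡ x y w u) (regroupʳ z w v y) (+-mono-≤ xy≤zw wu≤vy))
  where
  regroupˡ : ∀ a b c d → (a + b) + (c + d) ≡ (a + d) + (b + c)
  regroupˡ = solve 4 (λ a b c d → (a :+ b) :+ (c :+ d) := (a :+ d) :+ (b :+ c)) refl
  regroupʳ : ∀ a b c d → (a + b) + (c + d) ≡ (a + c) + (d + b)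
  regroupʳ = solve 4 (λ a b c d → (a :+ b) :+ (c :+ d) := (a :+ c) :+ (d :+ b)) refl

p+[q-p]≡q : ∀ p q → p + (q - p) ≡ q
p+[q-p]≡q = solve 2 (λ p q → p :+ (q :- p) := q) refl

x∈p─q⇒x∉q : ∀ (p q : Subset n) {x} → x ∈ p ─ q → x ∉ q
x∈p─q⇒x∉q (_ ∷ p) (outside ∷ q) (there x∈p─q) (there x∈q) = x∈p─q⇒x∉q p q x∈p─q x∈q
x∈p─q⇒x∉q (_ ∷ p) (inside ∷ q)  (there x∈p─q) (there x∈q) = x∈p─q⇒x∉q p q x∈p─q x∈q

∪-lub : ∀ {p q r : Subset n} → p ⊆ r → q ⊆ r → p ∪ q ⊆ r
∪-lub {p = p} {q} p⊆r q⊆r x∈p∪q with x∈p∪q⁻ p q x∈p∪q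
... | inj₁ x∈p = p⊆r x∈p
... | inj₂ x∈q = q⊆r x∈q

─-monoˡ-⊆ : ∀ {p q : Subset n} r → p ⊆ q → p ─ r ⊆ q ─ r
─-monoˡ-⊆ {p = p} r p⊆q x∈p─r = x∈p∧x∉q⇒x∈p─q (p⊆q (p─q⊆p p r x∈p─r)) (x∈p─q⇒x∉q p r x∈p─r)

p⊆q∪r⇒p─r⊆q : ∀ {p q r : Subset n} → p ⊆ q ∪ r → p ─ r ⊆ q
p⊆q∪r⇒p─r⊆q {p = p} {q} {r} p⊆q∪r x∈p─r with x∈p∪q⁻ q r (p⊆q∪r (p─q⊆p p r x∈p─r))
... | inj₁ x∈q = x∈q
... | inj₂ x∈r = contradiction x∈r (x∈p─q⇒x∉q p r x∈p─r)

p─q⊆r⇒p⊆r∪q : ∀ {p q r : Subset n} → p ─ q ⊆ r → p ⊆ r ∪ q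
p─q⊆r⇒p⊆r∪q {q = q} {r} p─q⊆r {x} x∈p with x ∈? q
... | yes x∈q = q⊆p∪q r q x∈q
... | no  x∉q = p⊆p∪q q (p─q⊆r (x∈p∧x∉q⇒x∈p─q x∈p x∉q))

─-distribʳ-∪ : ∀ (p q r : Subset n) → (p ∪ q) ─ r ≡ (p ─ r) ∪ (q ─ r)
─-distribʳ-∪ []      []      []            = refl
─-distribʳ-∪ (_ ∷ p) (_ ∷ q) (inside ∷ r)  = cong (outside ∷_) (─-distribʳ-∪ p q r)
─-distribʳ-∪ (x ∷ p) (y ∷ q) (outside ∷ r) = cong (_ ∷_) (─-distribʳ-∪ p q r)

─-distribʳ-∩ : ∀ (p q r : Subset n) → (p ∩ q) ─ r ≡ (p ─ r) ∩ (q ─ r)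
─-distribʳ-∩ []      []      []            = refl
─-distribʳ-∩ (_ ∷ p) (_ ∷ q) (inside ∷ r)  = cong (outside ∷_) (─-distribʳ-∩ p q r)
─-distribʳ-∩ (x ∷ p) (y ∷ q) (outside ∷ r) = cong (_ ∷_) (─-distribʳ-∩ p q r)

p─q∪q≡p∪q : ∀ (p q : Subset n) → (p ─ q) ∪ q ≡ p ∪ q
p─q∪q≡p∪q []            []            = refl
p─q∪q≡p∪q (_       ∷ p) (outside ∷ q) = cong (_ ∷_) (p─q∪q≡p∪q p q)
p─q∪q≡p∪q (inside  ∷ p) (inside  ∷ q) = cong (inside ∷_) (p─q∪q≡p∪q p q)
p─q∪q≡p∪q (outside ∷ p) (inside  ∷ q) = cong (inside ∷_) (p─q∪q≡p∪q p q)

p∪q─q≡p─q : ∀ (p q : Subset n) → (p ∪ q) ─ q ≡ p ─ q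
p∪q─q≡p─q []            []            = refl
p∪q─q≡p─q (_       ∷ p) (inside  ∷ q) = cong (outside ∷_) (p∪q─q≡p─q p q)
p∪q─q≡p─q (inside  ∷ p) (outside ∷ q) = cong (inside ∷_) (p∪q─q≡p─q p q)
p∪q─q≡p─q (outside ∷ p) (outside ∷ q) = cong (outside ∷_) (p∪q─q≡p─q p q)

p∪q∪q≡p∪q : ∀ (p q : Subset n) → (p ∪ q) ∪ q ≡ p ∪ q
p∪q∪q≡p∪q p q = trans (∪-assoc p q q) (cong (p ∪_) (∪-idem q))

disjoint⇒p∪q─q≡p : ∀ {p q : Subset n} → (∀ x → x ∈ p → x ∉ q) → (p ∪ q) ─ q ≡ p
disjoint⇒p∪q─q≡p {p = p} {q} p∩q≡∅ = trans (p∪q─q≡p─q p q)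
  (⊆-antisym (p─q⊆p p q) (λ {x} x∈p → x∈p∧x∉q⇒x∈p─q x∈p (p∩q≡∅ x x∈p)))

AgreeOn : (Subset n → ℚ) → (Subset n → ℚ) → Subset n → Set
AgreeOn g f M = ∀ A → A ⊆ M → g A ≡ f A

Monotone : (Subset n → ℚ) → Subset n → Set
Monotone f N = ∀ A B → A ⊆ B → B ⊆ N → f A ≤ f B

Submodular : (Subset n → ℚ) → Subset n → Set
Submodular f N = ∀ A B → A ⊆ N → B ⊆ N → f (A ∪ B) + f (A ∩ B) ≤ f A + f B

marginal-antitone : IsPolymatroid f M → ∀ {B C X} → C ⊆ B → B ⊆ M → X ⊆ M →
                    f (B ∪ X) + f C ≤ f B + f (C ∪ X)
marginal-antitone {f = f} {M} f-poly {B} {C} {X} C⊆B B⊆M X⊆M = begin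
  f (B ∪ X) + f C                   ≤⟨ +-mono-≤ (monotone _ _ B∪X⊆B∪C∪X (∪-lub B⊆M C∪X⊆M))
                                                (monotone _ _ C⊆B∩[C∪X] (⊆-trans (p∩q⊆p B _) B⊆M)) ⟩
  f (B ∪ (C ∪ X)) + f (B ∩ (C ∪ X)) ≤⟨ submodular B (C ∪ X) B⊆M C∪X⊆M ⟩
  f B + f (C ∪ X)                   ∎
  where
  open IsPolymatroid f-poly
  open ≤-Reasoning
  C∪X⊆M : C ∪ X ⊆ M
  C∪X⊆M = ∪-lub (⊆-trans C⊆B B⊆M) X⊆M
  B∪X⊆B∪C∪X : B ∪ X ⊆ B ∪ (C ∪ X)
  B∪X⊆B∪C∪X = ∪-lub (p⊆p∪q _) (⊆-trans (q⊆p∪q C X) (q⊆p∪q B _))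
  C⊆B∩[C∪X] : C ⊆ B ∩ (C ∪ X)
  C⊆B∩[C∪X] x∈C = x∈p∩q⁺ (C⊆B x∈C , p⊆p∪q X x∈C)

glue : Subset n → (Subset n → ℚ) → (Subset n → ℚ) → Subset n → ℚ
glue M f h A with A ⊆? M
... | yes _ = f A
... | no  _ = h A

glue-⊆ : A ⊆ M → glue M f h A ≡ f A
glue-⊆ {A = A} {M = M} A⊆M with A ⊆? M
... | yes _   = refl
... | no  A⊈M = ⊥-elim (A⊈M A⊆M)

glue-agree : (A ⊆ M → f A ≡ h A) → glue M f h A ≡ h A
glue-agree {A = A} {M = M} f≡h with A ⊆? M
... | yes A⊆M = f≡h A⊆M
... | no  _   = refl

module Gluing {M N : Subset n} {f h : Subset n → ℚ}
  (f-poly : IsPolymatroid f M) (h-mono : Monotone h N) (h-sub : Submodular h N)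
  (f≤h : ∀ A → A ⊆ M → f A ≤ h A)
  (gap-antitone : ∀ B C → C ⊆ B → B ⊆ M → h B + f C ≤ f B + h C) where

  open IsPolymatroid f-poly
  open ≤-Reasoning

  glue≤h : ∀ A → glue M f h A ≤ h A
  glue≤h A with A ⊆? M
  ... | yes A⊆M = f≤h A A⊆M
  ... | no  _   = ≤-refl

  glue-monotone : Monotone (glue M f h) N
  glue-monotone A B A⊆B B⊆N with A ⊆? M | B ⊆? M
  ... | yes _   | yes B⊆M = monotone A B A⊆B B⊆M
  ... | yes A⊆M | no  _   = ≤-trans (f≤h A A⊆M) (h-mono A B A⊆B B⊆N)
  ... | no  A⊈M | yes B⊆M = ⊥-elim (A⊈M (⊆-trans A⊆B B⊆M))
  ... | no  _   | no  _   = h-mono A B A⊆B B⊆N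

  glue-submodular-across : ∀ {A B} → A ⊆ N → B ⊆ N → B ⊆ M →
                           glue M f h (A ∪ B) + glue M f h (A ∩ B) ≤ h A + f B
  glue-submodular-across {A} {B} A⊆N B⊆N B⊆M = begin
    glue M f h (A ∪ B) + glue M f h (A ∩ B)
      ≤⟨ +-mono-≤ (glue≤h (A ∪ B)) (≤-reflexive (glue-⊆ (⊆-trans (p∩q⊆q A B) B⊆M))) ⟩
    h (A ∪ B) + f (A ∩ B)
      ≤⟨ ≤-exchange-trans (h (A ∪ B)) (h (A ∩ B)) (h A) (h B) (f (A ∩ B)) (f B)
           (h-sub A B A⊆N B⊆N) (gap-antitone B (A ∩ B) (p∩q⊆q A B) B⊆M) ⟩
    h A + f B ∎

  glue-submodular : Submodular (glue M f h) N
  glue-submodular A B A⊆N B⊆N with A ⊆? M | B ⊆? M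
  ... | yes A⊆M | yes B⊆M = begin
    glue M f h (A ∪ B) + glue M f h (A ∩ B)
      ≡⟨ cong₂ _+_ (glue-⊆ (∪-lub A⊆M B⊆M)) (glue-⊆ (⊆-trans (p∩q⊆p A B) A⊆M)) ⟩
    f (A ∪ B) + f (A ∩ B)
      ≤⟨ submodular A B A⊆M B⊆M ⟩
    f A + f B ∎
  ... | no  _   | yes B⊆M = glue-submodular-across A⊆N B⊆N B⊆M
  ... | yes A⊆M | no  _   = begin
    glue M f h (A ∪ B) + glue M f h (A ∩ B)
      ≡⟨ cong₂ _+_ (cong (glue M f h) (∪-comm A B)) (cong (glue M f h) (∩-comm A B)) ⟩
    glue M f h (B ∪ A) + glue M f h (B ∩ A)
      ≤⟨ glue-submodular-across B⊆N A⊆N A⊆M ⟩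
    h B + f A
      ≡⟨ +-comm (h B) (f A) ⟩
    f A + h B ∎
  ... | no  _   | no  _   = begin
    glue M f h (A ∪ B) + glue M f h (A ∩ B)
      ≤⟨ +-mono-≤ (glue≤h (A ∪ B)) (glue≤h (A ∩ B)) ⟩
    h (A ∪ B) + h (A ∩ B)
      ≤⟨ h-sub A B A⊆N B⊆N ⟩
    h A + h B ∎

  glue-empty : glue M f h ⊥ ≡ 0ℚ
  glue-empty = trans (glue-⊆ {f = f} {h = h} ⊥⊆) empty

  glue-isPolymatroid : IsPolymatroid (glue M f h) N
  glue-isPolymatroid = record
    { empty      = glue-empty
    ; nonneg     = λ A A⊆N → subst (_≤ glue M f h A) glue-empty (glue-monotone ⊥ A ⊥⊆ A⊆N)
    ; monotone   = glue-monotone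
    ; submodular = glue-submodular
    }

uncontract : (Subset n → ℚ) → Subset n → (Subset n → ℚ) → Subset n → ℚ
uncontract f X g' A = f X + g' (A ─ X)

uncontract-monotone : Monotone g' N → Monotone (uncontract f X g') (N ∪ X)
uncontract-monotone {f = f} {X = X} g'-mono A B A⊆B B⊆N∪X =
  +-monoʳ-≤ (f X) (g'-mono (A ─ X) (B ─ X) (─-monoˡ-⊆ X A⊆B) (p⊆q∪r⇒p─r⊆q B⊆N∪X))

uncontract-submodular : Submodular g' N → Submodular (uncontract f X g') (N ∪ X)
uncontract-submodular {g' = g'} {f = f} {X = X} g'-sub A B A⊆N∪X B⊆N∪X =
  subst₂ _≤_ (shift (A ∪ B) (A ∩ B)) (shift A B) (+-monoˡ-≤ (f X + f X) g'-sub-A─X-B─X)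
  where
  g'-sub-A─X-B─X : g' ((A ∪ B) ─ X) + g' ((A ∩ B) ─ X) ≤ g' (A ─ X) + g' (B ─ X)
  g'-sub-A─X-B─X = subst₂ (λ U V → g' U + g' V ≤ g' (A ─ X) + g' (B ─ X))
    (sym (─-distribʳ-∪ A B X)) (sym (─-distribʳ-∩ A B X))
    (g'-sub (A ─ X) (B ─ X) (p⊆q∪r⇒p─r⊆q A⊆N∪X) (p⊆q∪r⇒p─r⊆q B⊆N∪X))
  shift : ∀ C D →
          (g' (C ─ X) + g' (D ─ X)) + (f X + f X) ≡ uncontract f X g' C + uncontract f X g' D
  shift C D = solve 3 (λ c d e → (c :+ d) :+ (e :+ e) := (e :+ c) :+ (e :+ d)) refl
                (g' (C ─ X)) (g' (D ─ X)) (f X)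

uncontract-⊆ : AgreeOn g' (contractFn f X) (M ─ X) →
               A ⊆ M → uncontract f X g' A ≡ f (A ∪ X)
uncontract-⊆ {g' = g'} {f = f} {X = X} {A = A} g'-extends A⊆M = begin
  f X + g' (A ─ X)                ≡⟨ cong (f X +_) (g'-extends (A ─ X) (─-monoˡ-⊆ X A⊆M)) ⟩
  f X + (f ((A ─ X) ∪ X) - f X)   ≡⟨ cong (λ B → f X + (f B - f X)) (p─q∪q≡p∪q A X) ⟩
  f X + (f (A ∪ X) - f X)         ≡⟨ p+[q-p]≡q (f X) (f (A ∪ X)) ⟩
  f (A ∪ X)                       ∎
  where open ≡-Reasoning

≤-uncontract : IsPolymatroid f M → X ⊆ M → AgreeOn g' (contractFn f X) (M ─ X) →
               ∀ A → A ⊆ M → f A ≤ uncontract f X g' A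
≤-uncontract {f = f} {X = X} f-poly X⊆M g'-extends A A⊆M =
  ≤-trans (monotone A (A ∪ X) (p⊆p∪q X) (∪-lub A⊆M X⊆M))
          (≤-reflexive (sym (uncontract-⊆ {f = f} g'-extends A⊆M)))
  where open IsPolymatroid f-poly

uncontract-gap-antitone : IsPolymatroid f M → X ⊆ M → AgreeOn g' (contractFn f X) (M ─ X) →
                          ∀ B C → C ⊆ B → B ⊆ M →
                          uncontract f X g' B + f C ≤ f B + uncontract f X g' C
uncontract-gap-antitone {f = f} f-poly X⊆M g'-extends B C C⊆B B⊆M =
  subst₂ (λ hB hC → hB + f C ≤ f B + hC)
    (sym (uncontract-⊆ {f = f} g'-extends B⊆M))
    (sym (uncontract-⊆ {f = f} g'-extends (⊆-trans C⊆B B⊆M)))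
    (marginal-antitone f-poly C⊆B B⊆M X⊆M)

contract-glue-uncontract : X ⊆ M → AgreeOn g' (contractFn f X) (M ─ X) → (∀ x → x ∈ A → x ∉ X) →
                           g' A ≡ contractFn (glue M f (uncontract f X g')) X A
contract-glue-uncontract {X = X} {M = M} {g' = g'} {f = f} {A = A} X⊆M g'-extends A∩X≡∅ = begin
  g' A                                  ≡⟨ cong g' (sym (disjoint⇒p∪q─q≡p A∩X≡∅)) ⟩
  g' ((A ∪ X) ─ X)                      ≡⟨ sym (xyx⁻¹≈y (f X) _) ⟩
  uncontract f X g' (A ∪ X) - f X       ≡⟨ cong₂ _-_ (sym (glue-agree agree)) (sym (glue-⊆ X⊆M)) ⟩
  contractFn (glue M f (uncontract f X g')) X A ∎
  where
  open ≡-Reasoning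
  agree : A ∪ X ⊆ M → f (A ∪ X) ≡ uncontract f X g' (A ∪ X)
  agree A∪X⊆M = trans (cong f (sym (p∪q∪q≡p∪q A X))) (sym (uncontract-⊆ {f = f} g'-extends A∪X⊆M))

theorem4 : {u : ℕ} (f : Subset u → ℚ) (M X : Subset u) →
    IsPolymatroid f M → X ⊂ M →
    (g' : Subset u → ℚ) (N' : Subset u) →
    (∀ x → x ∈ N' → x ∉ X) →
    IsPolymatroid g' N' → IsExtension g' N' (contractFn f X) (M ─ X) →
    Σ[ g ∈ (Subset u → ℚ) ]
      (IsPolymatroid g (N' ∪ X) × IsExtension g (N' ∪ X) f M ×
       ((N' ∪ X) ─ X ≡ N') × (∀ A → A ⊆ N' → g' A ≡ contractFn g X A))
theorem4 f M X f-poly X⊂M g' N' N'∩X≡∅ g'-poly (M─X⊆N' , g'-extends) =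
  glue M f (uncontract f X g') ,
  glue-isPolymatroid ,
  (p─q⊆r⇒p⊆r∪q M─X⊆N' , λ A → glue-⊆) ,
  disjoint⇒p∪q─q≡p N'∩X≡∅ ,
  λ A A⊆N' → contract-glue-uncontract X⊆M g'-extends (λ x x∈A → N'∩X≡∅ x (A⊆N' x∈A))
  where
  X⊆M : X ⊆ M
  X⊆M = p⊂q⇒p⊆q X⊂M
  open IsPolymatroid g'-poly using () renaming (monotone to g'-mono; submodular to g'-sub)
  open Gluing f-poly
    (uncontract-monotone {g' = g'} {f = f} {X = X} g'-mono)
    (uncontract-submodular {g' = g'} {f = f} {X = X} g'-sub)
    (≤-uncontract f-poly X⊆M g'-extends) (uncontract-gap-antitone f-poly X⊆M g'-extends)
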